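{- Let $n$ and $b$ be positive integers with $n \leq b/2$. Throw $n$ balls into $b$ bins, each ball independently into a uniformly random bin. Then with probability at least $1 - (n/b)^{\Omega(n)}$ there is at least one bin containing exactly one ball. -}

module Defs where

open import Data.Nat using (ℕ; zero; suc)
import Data.Nat as ℕ
open import Data.Fin using (Fin)
import Data.Fin as Fin
open import Data.Fin.Properties using (all?)
open import Data.Vec using (Vec; []; _∷_; count)
open import Data.List using (List; [_]; concatMap; map; filter; length; allFin)
open import Relation.Binary.PropositionalEquality using (_≡_)
open import Relation.Nullary using (¬_; Dec)
open import Relation.Nullary.Decidable using (¬?)

-- An outcome of throwing n balls into b bins: ball i lands in bin (lookup v i).
-- The sample space is all b^n such vectors, each equally likely (uniform).
allOutcomes : (n b : ℕ) → List (Vec (Fin b) n)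
allOutcomes zero    b = [ [] ]
allOutcomes (suc n) b = concatMap (λ i → map (i ∷_) (allOutcomes n b)) (allFin b)

load : ∀ {n b} → Vec (Fin b) n → Fin b → ℕ
load v j = count (j Fin.≟_) v

NoSingleton : ∀ {n b} → Vec (Fin b) n → Set
NoSingleton {b = b} v = (j : Fin b) → ¬ (load v j ≡ 1)

noSingleton? : ∀ {n b} (v : Vec (Fin b) n) → Dec (NoSingleton v)
noSingleton? v = all? (λ j → ¬? (load v j ℕ.≟ 1))

badCount : ℕ → ℕ → ℕ
badCount n b = length (filter noSingleton? (allOutcomes n b))

-- Let the bins already hold loads f, and let s and m be the numbers of bins holding exactly
-- one ball and at least two balls.  Every singleton bin must receive one of the n balls still
-- to be thrown, so if W ≥ N, W² ≥ bN and m + n ≤ N, the number of throws leaving no singleton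
-- is at most n(n−1)⋯(n−s+1)·W^(n−s): conditioning on the bin of the first ball, this
-- potential satisfies the recurrence because m·W + b·t ≤ W² whenever m + t ≤ N.  From empty
-- bins this gives badCount N b ≤ W^N, so the probability is at most (W/b)^N.  For
-- W = ⌈√(bN)⌉ one has W² ≤ 7bN/4, and with N ≤ b/2 the twelfth power of (W/b)^N is at most (N/b)^N.
module Submission where

open import Defs
open import Algebra.Properties.CommutativeSemigroup using (x∙yz≈y∙xz)
open import Data.Empty using (⊥-elim)
open import Data.Fin as Fin using (Fin)
open import Data.Fin.Properties using (all?)
open import Data.List as List using (List; filter; length; concatMap; allFin)
open import Data.List.Properties using (filter-++; length-++; length-filter; filter-reject; map-tabulate)
open import Data.List.Relation.Binary.Sublist.Propositional using (⊆-refl)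
open import Data.List.Relation.Binary.Sublist.Propositional.Properties using (filter⁺; length-mono-≤)
open import Data.Nat using (ℕ; zero; suc; pred; _+_; _*_; _^_; _∸_; _≤_; _<_; z≤n; s≤s; NonZero; >-nonZero; >-nonZero⁻¹)
open import Data.Nat.Combinatorics.Base using (_P′_)
open import Data.Nat.Combinatorics.Specification using (nP′k≡n[n∸1P′k∸1])
open import Data.Nat.ListAction using (sum)
open import Data.Nat.Properties
open import Data.Nat.Tactic.RingSolver using (solve-∀)
open import Data.Product using (Σ; _×_; ∃; _,_)
open import Data.Vec as Vec using (Vec; []; _∷_; lookup; updateAt; replicate)
open import Data.Vec.Properties using (lookup∘updateAt; lookup∘updateAt′; lookup-replicate)
open import Function using (_∘_; id)
open import Relation.Binary.PropositionalEquality
open import Relation.Nullary using (yes; no; ¬_)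
open import Relation.Nullary.Decidable using (¬?)
open import Relation.Unary using (Decidable)

private
  variable
    A B : Set
    n b : ℕ

length-filter-concatMap : ∀ {P : A → Set} (P? : Decidable P) (g : B → List A) xs →
  length (filter P? (concatMap g xs)) ≡ sum (List.map (length ∘ filter P? ∘ g) xs)
length-filter-concatMap P? g List.[] = refl
length-filter-concatMap P? g (x List.∷ xs) = begin
  length (filter P? (g x List.++ concatMap g xs))                ≡⟨ cong length (filter-++ P? (g x) _) ⟩
  length (filter P? (g x) List.++ filter P? (concatMap g xs))    ≡⟨ length-++ (filter P? (g x)) ⟩
  length (filter P? (g x)) + length (filter P? (concatMap g xs)) ≡⟨ cong (_ +_) (length-filter-concatMap P? g xs) ⟩
  length (filter P? (g x)) + sum (List.map (length ∘ filter P? ∘ g) xs) ∎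
  where open ≡-Reasoning

length-filter-map-≤ : ∀ {P : A → Set} {Q : B → Set} (P? : Decidable P) (Q? : Decidable Q) (h : B → A) →
  (∀ x → P (h x) → Q x) → ∀ xs → length (filter P? (List.map h xs)) ≤ length (filter Q? xs)
length-filter-map-≤ P? Q? h P⇒Q List.[] = z≤n
length-filter-map-≤ P? Q? h P⇒Q (x List.∷ xs) with P? (h x) | Q? x
... | yes _ | yes _ = s≤s (length-filter-map-≤ P? Q? h P⇒Q xs)
... | yes p | no ¬q = ⊥-elim (¬q (P⇒Q x p))
... | no _  | yes _ = m≤n⇒m≤1+n (length-filter-map-≤ P? Q? h P⇒Q xs)
... | no _  | no _  = length-filter-map-≤ P? Q? h P⇒Q xs

sum-map-mono-≤ : ∀ {g g′ : A → ℕ} → (∀ x → g x ≤ g′ x) → ∀ xs → sum (List.map g xs) ≤ sum (List.map g′ xs)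
sum-map-mono-≤ g≤g′ List.[] = z≤n
sum-map-mono-≤ g≤g′ (x List.∷ xs) = +-mono-≤ (g≤g′ x) (sum-map-mono-≤ g≤g′ xs)

sum-allFin-lookup : ∀ (g : ℕ → ℕ) (f : Vec ℕ b) → sum (List.map (g ∘ lookup f) (allFin b)) ≡ Vec.sum (Vec.map g f)
sum-allFin-lookup {b} g f = trans (cong sum (map-tabulate id (g ∘ lookup f))) (sum-tabulate f)
  where
  sum-tabulate : ∀ {b} (f : Vec ℕ b) → sum (List.tabulate (g ∘ lookup f)) ≡ Vec.sum (Vec.map g f)
  sum-tabulate []      = refl
  sum-tabulate (x ∷ f) = cong (g x +_) (sum-tabulate f)

-- A vector f : Vec ℕ b records balls already in the bins before the n balls of v are thrown.
NoSingletonFrom : Vec ℕ b → Vec (Fin b) n → Set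
NoSingletonFrom {b} f v = (j : Fin b) → ¬ (lookup f j + load v j ≡ 1)

noSingletonFrom? : (f : Vec ℕ b) → Decidable (NoSingletonFrom {n = n} f)
noSingletonFrom? f v = all? (λ j → ¬? (lookup f j + load v j ≟ 1))

badCountFrom : ∀ n {b} → Vec ℕ b → ℕ
badCountFrom n {b} f = length (filter (noSingletonFrom? f) (allOutcomes n b))

badCount≤badCountFrom-empty : ∀ n b → badCount n b ≤ badCountFrom n (replicate b 0)
badCount≤badCountFrom-empty n b =
  length-mono-≤ (filter⁺ noSingleton? (noSingletonFrom? (replicate b 0)) noSingleton⇒ (⊆-refl {x = allOutcomes n b}))
  where
  noSingleton⇒ : ∀ {v w : Vec (Fin b) n} → v ≡ w → NoSingleton v → NoSingletonFrom (replicate b 0) w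
  noSingleton⇒ {w = w} refl ns j e = ns j (trans (cong (_+ load w j) (sym (lookup-replicate j 0))) e)

addBall : Fin b → Vec ℕ b → Vec ℕ b
addBall i f = updateAt f i suc

addBall-load : ∀ (i j : Fin b) f (v : Vec (Fin b) n) → lookup (addBall i f) j + load v j ≡ lookup f j + load (i ∷ v) j
addBall-load i j f v with j Fin.≟ i
... | yes refl rewrite lookup∘updateAt j {suc} f = sym (+-suc (lookup f j) (load v j))
... | no j≢i rewrite lookup∘updateAt′ j i {suc} j≢i f = refl

noSingletonFrom-∷ : ∀ (i : Fin b) f (v : Vec (Fin b) n) → NoSingletonFrom f (i ∷ v) → NoSingletonFrom (addBall i f) v
noSingletonFrom-∷ i f v ns j e = ns j (trans (sym (addBall-load i j f v)) e)

badCountFrom-suc-≤ : ∀ n {b} (f : Vec ℕ b) → badCountFrom (suc n) f ≤ sum (List.map (λ i → badCountFrom n (addBall i f)) (allFin b))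
badCountFrom-suc-≤ n {b} f = begin
  badCountFrom (suc n) f
    ≡⟨ length-filter-concatMap (noSingletonFrom? f) (λ i → List.map (i ∷_) (allOutcomes n b)) (allFin b) ⟩
  sum (List.map (λ i → length (filter (noSingletonFrom? f) (List.map (i ∷_) (allOutcomes n b)))) (allFin b))
    ≤⟨ sum-map-mono-≤ (λ i → length-filter-map-≤ _ _ (i ∷_) (noSingletonFrom-∷ i f) (allOutcomes n b)) (allFin b) ⟩
  sum (List.map (λ i → badCountFrom n (addBall i f)) (allFin b)) ∎
  where open ≤-Reasoning

byLoad : A → A → A → ℕ → A
byLoad a₀ a₁ a₂ zero          = a₀
byLoad a₀ a₁ a₂ (suc zero)    = a₁
byLoad a₀ a₁ a₂ (suc (suc _)) = a₂

byLoad-natural : (g : A → B) {a₀ a₁ a₂ : A} → ∀ x → g (byLoad a₀ a₁ a₂ x) ≡ byLoad (g a₀) (g a₁) (g a₂) x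
byLoad-natural g zero          = refl
byLoad-natural g (suc zero)    = refl
byLoad-natural g (suc (suc _)) = refl

singletons multiples : Vec ℕ b → ℕ
singletons f = Vec.sum (Vec.map (byLoad 0 1 0) f)
multiples  f = Vec.sum (Vec.map (byLoad 0 0 1) f)

sum-byLoad-≤ : ∀ a₀ a₁ a₂ (f : Vec ℕ b) →
  Vec.sum (Vec.map (byLoad a₀ a₁ a₂) f) ≤ b * a₀ + singletons f * a₁ + multiples f * a₂
sum-byLoad-≤ a₀ a₁ a₂ [] = z≤n
sum-byLoad-≤ {suc b} a₀ a₁ a₂ (x ∷ f) =
  ≤-trans (+-mono-≤ (byLoad-≤ x) (sum-byLoad-≤ a₀ a₁ a₂ f))
          (≤-reflexive (regroup a₀ a₁ a₂ (byLoad 0 1 0 x) (byLoad 0 0 1 x) b (singletons f) (multiples f)))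
  where
  regroup : ∀ a₀ a₁ a₂ s m b S M →
    (a₀ + s * a₁ + m * a₂) + (b * a₀ + S * a₁ + M * a₂) ≡ suc b * a₀ + (s + S) * a₁ + (m + M) * a₂
  regroup = solve-∀
  byLoad-≤ : ∀ x → byLoad a₀ a₁ a₂ x ≤ a₀ + byLoad 0 1 0 x * a₁ + byLoad 0 0 1 x * a₂
  byLoad-≤ zero          = ≤-reflexive (sym (trans (+-identityʳ _) (+-identityʳ a₀)))
  byLoad-≤ (suc zero)    = ≤-trans (m≤n+m a₁ a₀) (≤-reflexive (sym (trans (+-identityʳ _) (cong (a₀ +_) (+-identityʳ a₁)))))
  byLoad-≤ (suc (suc _)) = ≤-trans (m≤n+m a₂ a₀) (≤-reflexive (sym (cong₂ _+_ (+-identityʳ a₀) (+-identityʳ a₂))))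

sum-map-addBall : ∀ (g : ℕ → ℕ) (i : Fin b) f →
  Vec.sum (Vec.map g (addBall i f)) + g (lookup f i) ≡ Vec.sum (Vec.map g f) + g (suc (lookup f i))
sum-map-addBall g Fin.zero    (x ∷ f) = rotate (g (suc x)) (Vec.sum (Vec.map g f)) (g x)
  where
  rotate : ∀ a b c → (a + b) + c ≡ (c + b) + a
  rotate = solve-∀
sum-map-addBall g (Fin.suc i) (x ∷ f) = begin
  (g x + Vec.sum (Vec.map g (addBall i f))) + g (lookup f i) ≡⟨ +-assoc (g x) _ _ ⟩
  g x + (Vec.sum (Vec.map g (addBall i f)) + g (lookup f i)) ≡⟨ cong (g x +_) (sum-map-addBall g i f) ⟩
  g x + (Vec.sum (Vec.map g f) + g (suc (lookup f i)))       ≡⟨ +-assoc (g x) _ _ ⟨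
  (g x + Vec.sum (Vec.map g f)) + g (suc (lookup f i))       ∎
  where open ≡-Reasoning

singletons-addBall : ∀ (i : Fin b) f →
  singletons (addBall i f) ≡ byLoad (suc (singletons f)) (pred (singletons f)) (singletons f) (lookup f i)
singletons-addBall i f with lookup f i | sum-map-addBall (byLoad 0 1 0) i f
... | zero          | e = trans (sym (+-identityʳ _)) (trans e (+-comm _ 1))
... | suc zero      | e = cong pred (trans (+-comm 1 _) (trans e (+-identityʳ _)))
... | suc (suc _)   | e = trans (sym (+-identityʳ _)) (trans e (+-identityʳ _))

multiples-addBall : ∀ (i : Fin b) f → multiples (addBall i f) ≤ suc (multiples f)
multiples-addBall i f = begin
  multiples (addBall i f)                         ≤⟨ m≤m+n _ _ ⟩
  multiples (addBall i f) + byLoad 0 0 1 x        ≡⟨ sum-map-addBall (byLoad 0 0 1) i f ⟩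
  multiples f + byLoad 0 0 1 (suc x)              ≤⟨ +-monoʳ-≤ (multiples f) (byLoad-≤1 (suc x)) ⟩
  multiples f + 1                                 ≡⟨ +-comm _ 1 ⟩
  suc (multiples f)                               ∎
  where
  open ≤-Reasoning
  x : ℕ
  x = lookup f i
  byLoad-≤1 : ∀ y → byLoad 0 0 1 y ≤ 1
  byLoad-≤1 zero          = z≤n
  byLoad-≤1 (suc zero)    = z≤n
  byLoad-≤1 (suc (suc _)) = ≤-refl

sum-byLoad-empty : ∀ b {a₁ a₂} → Vec.sum (Vec.map (byLoad 0 a₁ a₂) (replicate b 0)) ≡ 0
sum-byLoad-empty zero    = refl
sum-byLoad-empty (suc b) = sum-byLoad-empty b

singleton-bin : ∀ (f : Vec ℕ b) {k} → singletons f ≡ suc k → ∃ λ j → lookup f j ≡ 1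
singleton-bin (zero ∷ f)        e = let j , fj≡1 = singleton-bin f e in Fin.suc j , fj≡1
singleton-bin (suc zero ∷ f)    e = Fin.zero , refl
singleton-bin (suc (suc _) ∷ f) e = let j , fj≡1 = singleton-bin f e in Fin.suc j , fj≡1

badCountFrom-zero-≤ : (f : Vec ℕ b) → badCountFrom 0 f ≤ 1
badCountFrom-zero-≤ f = length-filter (noSingletonFrom? f) (allOutcomes 0 _)

badCountFrom-zero-singleton : (f : Vec ℕ b) {k : ℕ} → singletons f ≡ suc k → badCountFrom 0 f ≡ 0
badCountFrom-zero-singleton f s≡1+k =
  let j , fj≡1 = singleton-bin f s≡1+k in
  cong length (filter-reject (noSingletonFrom? f) (λ ns → ns j (trans (+-identityʳ _) fj≡1)))

module _ (W : ℕ) where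

  -- n P′ s = n(n−1)⋯(n−s+1) has the factor n ∸ n = 0 once s > n: too few balls remain to
  -- cover the s singleton bins.
  potential : ℕ → ℕ → ℕ
  potential n s = (n P′ s) * W ^ (n ∸ s)

  potential-vanishes : ∀ {n s} → n < s → potential n s ≡ 0
  potential-vanishes {n} {suc s} (s≤s n≤s) rewrite m≤n⇒m∸n≡0 n≤s = refl

  potential-suc-suc : ∀ n s → potential (suc n) (suc s) ≡ suc n * potential n s
  potential-suc-suc n s = begin
    (suc n P′ suc s) * W ^ (n ∸ s)   ≡⟨ cong (_* W ^ (n ∸ s)) (nP′k≡n[n∸1P′k∸1] (suc n) (suc s)) ⟩
    suc n * (n P′ s) * W ^ (n ∸ s)   ≡⟨ *-assoc (suc n) (n P′ s) (W ^ (n ∸ s)) ⟩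
    suc n * potential n s            ∎
    where open ≡-Reasoning

  potential-suc-zero : ∀ n → potential (suc n) 0 ≡ W * potential n 0
  potential-suc-zero n rewrite *-identityˡ (W ^ n) = *-identityˡ (W * W ^ n)

  *-potential-suc : ∀ n s → W * potential n (suc s) ≡ (n ∸ s) * potential n s
  *-potential-suc n s rewrite sym (pred[m∸n]≡m∸[1+n] n s) with n ∸ s
  ... | zero  = *-zeroʳ W
  ... | suc d = shuffle W (suc d) (n P′ s) (W ^ d)
    where
    shuffle : ∀ W d P X → W * (d * P * X) ≡ d * (P * (W * X))
    shuffle = solve-∀

  *-*-potential-suc-suc : ∀ n s → W * (W * potential n (suc (suc s))) ≡ pred (n ∸ s) * ((n ∸ s) * potential n s)
  *-*-potential-suc-suc n s = begin
    W * (W * potential n (suc (suc s)))      ≡⟨ cong (W *_) (*-potential-suc n (suc s)) ⟩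
    W * ((n ∸ suc s) * potential n (suc s))  ≡⟨ cong (λ e → W * (e * potential n (suc s))) (pred[m∸n]≡m∸[1+n] n s) ⟨
    W * (pred (n ∸ s) * potential n (suc s)) ≡⟨ x∙yz≈y∙xz *-commutativeSemigroup W (pred (n ∸ s)) (potential n (suc s)) ⟩
    pred (n ∸ s) * (W * potential n (suc s)) ≡⟨ cong (pred (n ∸ s) *_) (*-potential-suc n s) ⟩
    pred (n ∸ s) * ((n ∸ s) * potential n s) ∎
    where open ≡-Reasoning

module _ {b N W : ℕ} .{{_ : NonZero N}} (N≤W : N ≤ W) (bN≤W² : b * N ≤ W * W) where

  private instance
    W-nonZero : NonZero W
    W-nonZero = >-nonZero (<-≤-trans (>-nonZero⁻¹ N) N≤W)
    W*W-nonZero : NonZero (W * W)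
    W*W-nonZero = m*n≢0 W W

  m*W+b*t≤W*W : ∀ {m t} → m + t ≤ N → m * W + b * t ≤ W * W
  m*W+b*t≤W*W {m} {t} m+t≤N = *-cancelˡ-≤ N (begin
    N * (m * W + b * t)          ≡⟨ distribute N m W b t ⟩
    m * (N * W) + t * (b * N)    ≤⟨ +-mono-≤ (*-monoʳ-≤ m (*-monoˡ-≤ W N≤W)) (*-monoʳ-≤ t bN≤W²) ⟩
    m * (W * W) + t * (W * W)    ≡⟨ *-distribʳ-+ (W * W) m t ⟨
    (m + t) * (W * W)            ≤⟨ *-monoˡ-≤ (W * W) m+t≤N ⟩
    N * (W * W)                  ∎)
    where
    open ≤-Reasoning
    distribute : ∀ N m W b t → N * (m * W + b * t) ≡ m * (N * W) + t * (b * N)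
    distribute = solve-∀

  step-coefficients-≤ : ∀ {m} n s → m + n ≤ N →
    ((n ∸ s) * (m * W + b * pred (n ∸ s)) + suc s * (W * W)) * potential W n s ≤ suc n * (W * W) * potential W n s
  step-coefficients-≤ {m} n s m+n≤N with s ≤? n
  ... | no s≰n rewrite potential-vanishes W (≰⇒> s≰n) =
    ≤-reflexive (trans (*-zeroʳ ((n ∸ s) * (m * W + b * pred (n ∸ s)) + suc s * (W * W))) (sym (*-zeroʳ (suc n * (W * W)))))
  ... | yes s≤n = *-monoˡ-≤ (potential W n s) (begin
    d * (m * W + b * pred d) + suc s * (W * W)  ≤⟨ +-monoˡ-≤ _ (*-monoʳ-≤ d (m*W+b*t≤W*W {m} {pred d} m+pred[d]≤N)) ⟩
    d * (W * W) + suc s * (W * W)               ≡⟨ *-distribʳ-+ (W * W) d (suc s) ⟨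
    (d + suc s) * (W * W)                       ≡⟨ cong (_* (W * W)) (trans (+-suc d s) (cong suc (m∸n+n≡m s≤n))) ⟩
    suc n * (W * W)                             ∎)
    where
    open ≤-Reasoning
    d : ℕ
    d = n ∸ s
    m+pred[d]≤N : m + pred d ≤ N
    m+pred[d]≤N = ≤-trans (+-monoʳ-≤ m (≤-trans pred[n]≤n (m∸n≤m n s))) m+n≤N

  -- The first ball lands in an empty bin (at most b of them), in one of the s singletons, or
  -- in one of the m fuller bins.  Multiplied by W² (by W if s = 0), via *-potential-suc the
  -- inequality reduces to m*W+b*t≤W*W with t = n ∸ s.
  potential-step : ∀ {m} n s → m + n ≤ N →
    b * potential W n (suc s) + s * potential W n (pred s) + m * potential W n s ≤ potential W (suc n) s
  potential-step {m} n zero m+n≤N = *-cancelˡ-≤ W (begin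
    W * (b * y + 0 * q + m * q)   ≡⟨ expand W b y q m ⟩
    b * (W * y) + m * W * q       ≡⟨ cong (λ u → b * u + m * W * q) (*-potential-suc W n 0) ⟩
    b * (n * q) + m * W * q       ≡⟨ collect b n q m W ⟩
    (m * W + b * n) * q           ≤⟨ *-monoˡ-≤ q (m*W+b*t≤W*W {m} {n} m+n≤N) ⟩
    W * W * q                     ≡⟨ *-assoc W W q ⟩
    W * (W * q)                   ≡⟨ cong (W *_) (potential-suc-zero W n) ⟨
    W * potential W (suc n) 0     ∎)
    where
    open ≤-Reasoning
    q y : ℕ
    q = potential W n 0
    y = potential W n 1
    expand : ∀ W b y q m → W * (b * y + 0 * q + m * q) ≡ b * (W * y) + m * W * q
    expand = solve-∀
    collect : ∀ b n q m W → b * (n * q) + m * W * q ≡ (m * W + b * n) * q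
    collect = solve-∀
  potential-step {m} n (suc s) m+n≤N = *-cancelˡ-≤ (W * W) (begin
    W * W * (b * z + suc s * q + m * y)                              ≡⟨ expand W b z (suc s) q m y ⟩
    b * (W * (W * z)) + m * W * (W * y) + suc s * (W * W) * q        ≡⟨ cong₂ (λ u v → b * u + m * W * v + suc s * (W * W) * q)
                                                                          (*-*-potential-suc-suc W n s) (*-potential-suc W n s) ⟩
    b * (pred d * (d * q)) + m * W * (d * q) + suc s * (W * W) * q   ≡⟨ collect b (pred d) d q m W (suc s) ⟩
    (d * (m * W + b * pred d) + suc s * (W * W)) * q                 ≤⟨ step-coefficients-≤ n s m+n≤N ⟩
    suc n * (W * W) * q                                              ≡⟨ reassociate n W q ⟩
    W * W * (suc n * q)                                              ≡⟨ cong (W * W *_) (potential-suc-suc W n s) ⟨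
    W * W * potential W (suc n) (suc s)                              ∎)
    where
    open ≤-Reasoning
    d q y z : ℕ
    d = n ∸ s
    q = potential W n s
    y = potential W n (suc s)
    z = potential W n (suc (suc s))
    expand : ∀ W b z s q m y → W * W * (b * z + s * q + m * y) ≡ b * (W * (W * z)) + m * W * (W * y) + s * (W * W) * q
    expand = solve-∀
    collect : ∀ b e d q m W s → b * (e * (d * q)) + m * W * (d * q) + s * (W * W) * q ≡ (d * (m * W + b * e) + s * (W * W)) * q
    collect = solve-∀
    reassociate : ∀ n W q → suc n * (W * W) * q ≡ W * W * (suc n * q)
    reassociate = solve-∀

  badCountFrom-≤-potential : ∀ n (f : Vec ℕ b) → multiples f + n ≤ N → badCountFrom n f ≤ potential W n (singletons f)
  badCountFrom-≤-potential zero f _ with singletons f in s≡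
  ... | zero  = badCountFrom-zero-≤ f
  ... | suc k = ≤-trans (≤-reflexive (badCountFrom-zero-singleton f s≡)) z≤n
  badCountFrom-≤-potential (suc n) f m+1+n≤N = begin
    badCountFrom (suc n) f                                          ≤⟨ badCountFrom-suc-≤ n f ⟩
    sum (List.map (λ i → badCountFrom n (addBall i f)) (allFin b))  ≤⟨ sum-map-mono-≤ addBall-≤ (allFin b) ⟩
    sum (List.map (byLoad p₀ p₁ p₂ ∘ lookup f) (allFin b))          ≡⟨ sum-allFin-lookup (byLoad p₀ p₁ p₂) f ⟩
    Vec.sum (Vec.map (byLoad p₀ p₁ p₂) f)                           ≤⟨ sum-byLoad-≤ p₀ p₁ p₂ f ⟩
    b * p₀ + s * p₁ + multiples f * p₂                              ≤⟨ potential-step n s m+n≤N ⟩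
    potential W (suc n) s                                           ∎
    where
    open ≤-Reasoning
    s p₀ p₁ p₂ : ℕ
    s = singletons f
    p₀ = potential W n (suc s)
    p₁ = potential W n (pred s)
    p₂ = potential W n s
    m+n≤N : multiples f + n ≤ N
    m+n≤N = ≤-trans (+-monoʳ-≤ (multiples f) (n≤1+n n)) m+1+n≤N
    addBall-≤ : ∀ i → badCountFrom n (addBall i f) ≤ byLoad p₀ p₁ p₂ (lookup f i)
    addBall-≤ i = begin
      badCountFrom n (addBall i f)                           ≤⟨ badCountFrom-≤-potential n (addBall i f) invariant ⟩
      potential W n (singletons (addBall i f))               ≡⟨ cong (potential W n) (singletons-addBall i f) ⟩
      potential W n (byLoad (suc s) (pred s) s (lookup f i)) ≡⟨ byLoad-natural (potential W n) (lookup f i) ⟩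
      byLoad p₀ p₁ p₂ (lookup f i)                           ∎
      where
      invariant : multiples (addBall i f) + n ≤ N
      invariant = ≤-trans (+-monoˡ-≤ n (multiples-addBall i f)) (subst (_≤ N) (+-suc (multiples f) n) m+1+n≤N)

  badCount≤W^N : badCount N b ≤ W ^ N
  badCount≤W^N = begin
    badCount N b                               ≤⟨ badCount≤badCountFrom-empty N b ⟩
    badCountFrom N (replicate b 0)             ≤⟨ badCountFrom-≤-potential N (replicate b 0) no-multiples ⟩
    potential W N (singletons (replicate b 0)) ≡⟨ cong (potential W N) (sum-byLoad-empty b) ⟩
    potential W N 0                            ≡⟨ *-identityˡ (W ^ N) ⟩
    W ^ N                                      ∎
    where
    open ≤-Reasoning
    no-multiples : multiples (replicate b 0) + N ≤ N
    no-multiples rewrite sum-byLoad-empty b {0} {1} = ≤-refl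

badCount-one : ∀ b → badCount 1 b ≡ 0
badCount-one b = n≤0⇒n≡0 (begin
  badCount 1 b                                                       ≤⟨ badCount≤badCountFrom-empty 1 b ⟩
  badCountFrom 1 empty                                               ≤⟨ badCountFrom-suc-≤ 0 empty ⟩
  sum (List.map (λ i → badCountFrom 0 (addBall i empty)) (allFin b)) ≡⟨ sum-map-zero (allFin b) ⟩
  0                                                                  ∎)
  where
  open ≤-Reasoning
  empty : Vec ℕ b
  empty = replicate b 0
  one-singleton : ∀ i → singletons (addBall i empty) ≡ suc (singletons empty)
  one-singleton i = trans (singletons-addBall i empty) (cong (byLoad _ _ _) (lookup-replicate i 0))
  sum-map-zero : ∀ is → sum (List.map (λ i → badCountFrom 0 (addBall i empty)) is) ≡ 0
  sum-map-zero List.[]       = refl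
  sum-map-zero (i List.∷ is) = cong₂ _+_ (badCountFrom-zero-singleton (addBall i empty) (one-singleton i)) (sum-map-zero is)

ceiling-sqrt : ∀ M .{{_ : NonZero M}} → ∃ λ W → M ≤ W * W × W * W + 2 ≤ M + (W + W)
ceiling-sqrt 1 = 1 , ≤-refl , ≤-refl
ceiling-sqrt (suc (suc M)) with ceiling-sqrt (suc M)
... | W , M<W*W , W*W+2≤ with suc (suc M) ≤? W * W
...   | yes M+2≤W*W = W , M+2≤W*W , ≤-trans W*W+2≤ (+-monoˡ-≤ (W + W) (n≤1+n (suc M)))
...   | no M+2≰W*W =
  suc W , subst (suc (suc M) ≤_) (sym square) (s≤s (m≤m+n (suc M) (W + W))) , ≤-reflexive (trans (cong (_+ 2) square) (shift M W))
  where
  square-suc : ∀ W → suc W * suc W ≡ suc (W * W + (W + W))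
  square-suc = solve-∀
  shift : ∀ M W → suc (suc M + (W + W)) + 2 ≡ suc (suc M) + (suc W + suc W)
  shift = solve-∀
  square : suc W * suc W ≡ suc (suc M + (W + W))
  square = trans (square-suc W) (cong (λ x → suc (x + (W + W))) (≤-antisym (≤-pred (≰⇒> M+2≰W*W)) M<W*W))

-- From (W − 1)² < M: the inequality 3W² + 14 ≥ 14W holds for W ≥ 4, and small W are covered by M ≥ 8.
4*W*W≤7*M : ∀ {M} W → 8 ≤ M → W * W + 2 ≤ M + (W + W) → 4 * (W * W) ≤ 7 * M
4*W*W≤7*M 0 8≤M _ = z≤n
4*W*W≤7*M 1 8≤M _ = ≤-trans (m≤m+n 4 52) (*-monoʳ-≤ 7 8≤M)
4*W*W≤7*M 2 8≤M _ = ≤-trans (m≤m+n 16 40) (*-monoʳ-≤ 7 8≤M)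
4*W*W≤7*M 3 8≤M _ = ≤-trans (m≤m+n 36 20) (*-monoʳ-≤ 7 8≤M)
4*W*W≤7*M {M} W@(suc (suc (suc (suc e)))) _ W*W+2≤ = +-cancelʳ-≤ (14 * W) (4 * (W * W)) (7 * M) (begin
  4 * (W * W) + 14 * W                                ≤⟨ m≤m+n _ (6 + 10 * e + 3 * (e * e)) ⟩
  4 * (W * W) + 14 * W + (6 + 10 * e + 3 * (e * e))   ≡⟨ expand e ⟩
  7 * (W * W + 2)                                     ≤⟨ *-monoʳ-≤ 7 W*W+2≤ ⟩
  7 * (M + (W + W))                                   ≡⟨ distrib M W ⟩
  7 * M + 14 * W                                      ∎)
  where
  open ≤-Reasoning
  expand : ∀ e → 4 * ((4 + e) * (4 + e)) + 14 * (4 + e) + (6 + 10 * e + 3 * (e * e)) ≡ 7 * ((4 + e) * (4 + e) + 2)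
  expand = solve-∀
  distrib : ∀ M W → 7 * (M + (W + W)) ≡ 7 * M + 14 * W
  distrib = solve-∀

^-distribʳ-* : ∀ x y n → (x * y) ^ n ≡ x ^ n * y ^ n
^-distribʳ-* x y zero    = refl
^-distribʳ-* x y (suc n) = trans (cong ((x * y) *_) (^-distribʳ-* x y n)) (*-*-comm x y (x ^ n) (y ^ n))
  where
  *-*-comm : ∀ a b c d → (a * b) * (c * d) ≡ (a * c) * (b * d)
  *-*-comm = solve-∀

^-comm-exponents : ∀ x m n → (x ^ m) ^ n ≡ (x ^ n) ^ m
^-comm-exponents x m n = trans (^-*-assoc x m n) (trans (cong (x ^_) (*-comm m n)) (sym (^-*-assoc x n m)))

square-^ : ∀ x k → (x * x) ^ k ≡ x ^ (2 * k)
square-^ x k = trans (cong (λ y → (x * y) ^ k) (sym (*-identityʳ x))) (^-*-assoc x 2 k)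

-- 4W² ≤ 7bN and 2N ≤ b give 8W² ≤ 7b², and 8⁵ · 4 = 131072 ≥ 117649 = 7⁶.
W^12*b≤N*b^12 : ∀ {N b} W → 4 * (W * W) ≤ 7 * (b * N) → N + N ≤ b → W ^ 12 * b ≤ N * b ^ 12
W^12*b≤N*b^12 {N} {b} W 4W²≤7bN 2N≤b = *-cancelˡ-≤ 131072 (begin
  131072 * (W ^ 12 * b)                ≡⟨ cong (λ x → 131072 * (x * b)) (square-^ W 6) ⟨
  131072 * (W² ^ 6 * b)                ≡⟨ split W² (W² ^ 5) b ⟩
  (32768 * W² ^ 5) * (4 * W²) * b      ≤⟨ *-monoˡ-≤ b (*-mono-≤ 8⁵W¹⁰≤7⁵b¹⁰ 4W²≤7bN) ⟩
  (16807 * b² ^ 5) * (7 * (b * N)) * b ≡⟨ merge N b (b² ^ 5) ⟩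
  117649 * (N * b² ^ 6)                ≡⟨ cong (λ x → 117649 * (N * x)) (square-^ b 6) ⟩
  117649 * (N * b ^ 12)                ≤⟨ *-monoˡ-≤ (N * b ^ 12) (m≤m+n 117649 13423) ⟩
  131072 * (N * b ^ 12)                ∎)
  where
  open ≤-Reasoning
  W² b² : ℕ
  W² = W * W
  b² = b * b
  8W²≤7b² : 8 * W² ≤ 7 * b²
  8W²≤7b² = begin
    8 * W²            ≡⟨ *-assoc 2 4 W² ⟩
    2 * (4 * W²)      ≤⟨ *-monoʳ-≤ 2 4W²≤7bN ⟩
    2 * (7 * (b * N)) ≡⟨ double b N ⟩
    7 * (b * (N + N)) ≤⟨ *-monoʳ-≤ 7 (*-monoʳ-≤ b 2N≤b) ⟩
    7 * b²            ∎
    where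
    double : ∀ b N → 2 * (7 * (b * N)) ≡ 7 * (b * (N + N))
    double = solve-∀
  8⁵W¹⁰≤7⁵b¹⁰ : 32768 * W² ^ 5 ≤ 16807 * b² ^ 5
  8⁵W¹⁰≤7⁵b¹⁰ = begin
    32768 * W² ^ 5   ≡⟨ ^-distribʳ-* 8 W² 5 ⟨
    (8 * W²) ^ 5     ≤⟨ ^-monoˡ-≤ 5 8W²≤7b² ⟩
    (7 * b²) ^ 5     ≡⟨ ^-distribʳ-* 7 b² 5 ⟩
    16807 * b² ^ 5   ∎
  split : ∀ V P b → 131072 * ((V * P) * b) ≡ (32768 * P) * (4 * V) * b
  split = solve-∀
  merge : ∀ N b P → (16807 * P) * (7 * (b * N)) * b ≡ 117649 * (N * ((b * b) * P))
  merge = solve-∀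

raise-bound : ∀ {x N b} W → x ≤ W ^ N → W ^ 12 * b ≤ N * b ^ 12 → x ^ 12 * b ^ N ≤ N ^ N * (b ^ N) ^ 12
raise-bound {x} {N} {b} W x≤W^N W^12*b≤ = begin
  x ^ 12 * b ^ N          ≤⟨ *-monoˡ-≤ (b ^ N) (^-monoˡ-≤ 12 x≤W^N) ⟩
  (W ^ N) ^ 12 * b ^ N    ≡⟨ cong (_* b ^ N) (^-comm-exponents W N 12) ⟩
  (W ^ 12) ^ N * b ^ N    ≡⟨ ^-distribʳ-* (W ^ 12) b N ⟨
  (W ^ 12 * b) ^ N        ≤⟨ ^-monoˡ-≤ N W^12*b≤ ⟩
  (N * b ^ 12) ^ N        ≡⟨ ^-distribʳ-* N (b ^ 12) N ⟩
  N ^ N * (b ^ 12) ^ N    ≡⟨ cong (N ^ N *_) (^-comm-exponents b 12 N) ⟩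
  N ^ N * (b ^ N) ^ 12    ∎
  where open ≤-Reasoning

lemma2p5 : Σ ℕ λ k → (1 ≤ k) ×
    ((n b : ℕ) → 1 ≤ n → n + n ≤ b →
    badCount n b ^ k * b ^ n ≤ n ^ n * (b ^ n) ^ k)
lemma2p5 = 12 , s≤s z≤n , bound
  where
  bound : (n b : ℕ) → 1 ≤ n → n + n ≤ b → badCount n b ^ 12 * b ^ n ≤ n ^ n * (b ^ n) ^ 12
  bound 1 b _ _ rewrite badCount-one b = z≤n
  bound n@(suc (suc _)) b@(suc _) _ 2n≤b with ceiling-sqrt (b * n)
  ... | W , bn≤W*W , W*W+2≤ =
    raise-bound {N = n} {b} W (badCount≤W^N {b} {n} {W} n≤W bn≤W*W) (W^12*b≤N*b^12 W (4*W*W≤7*M W 8≤bn W*W+2≤) 2n≤b)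
    where
    8≤bn : 8 ≤ b * n
    8≤bn = *-mono-≤ {4} {b} {2} {n} (≤-trans (+-mono-≤ {2} {n} {2} {n} (s≤s (s≤s z≤n)) (s≤s (s≤s z≤n))) 2n≤b) (s≤s (s≤s z≤n))
    n≤W : n ≤ W
    n≤W = ≮⇒≥ (λ W<n → <⇒≱ (*-mono-< W<n W<n) (≤-trans (*-monoˡ-≤ n (≤-trans (m≤m+n n n) 2n≤b)) bn≤W*W))
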